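{- Let $G$ be a graph and let $u,v$ be two adjacent irredundant vertices of $G$. Then there exist $u'\in N[u]\setminus N[v]$, $u''\in N[u']\setminus N[u]$, $v'\in N[v]\setminus N[u]$ and $v''\in N[v']\setminus N[v]$. In particular, if $G$ is chordal, then $u''u'uvv'v''$ is an induced path on six vertices.
   Context: All graphs are finite, simple and undirected; $N[x]$ is the closed neighbourhood of $x$. A vertex $x$ is irredundant if $N[x]$ is inclusion-minimal in $\{N[y]:y\in V(G)\}$, with the convention that among several vertices having the same inclusion-minimal closed neighbourhood exactly one (fixed) is declared irredundant; all other vertices are redundant. A graph is chordal if it has no induced cycle of length at least four. -}

module Defs where

open import Data.Nat using (ℕ; zero; suc; _≤_)
open import Data.Fin using (Fin; toℕ)
open import Data.Product using (Σ; _×_; _,_)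
open import Data.Sum using (_⊎_)
open import Relation.Nullary using (¬_; Dec)
open import Relation.Binary.PropositionalEquality using (_≡_)
open import Function.Bundles using (_⇔_)

record Graph : Set₁ where
  field
    n      : ℕ
    Adj    : Fin n → Fin n → Set
    sym    : ∀ {x y} → Adj x y → Adj y x
    irrefl : ∀ {x} → ¬ Adj x x
    adj?   : ∀ x y → Dec (Adj x y)

module _ (G : Graph) where
  open Graph G

  Vertex : Set
  Vertex = Fin n

  N[_] : Vertex → Vertex → Set
  N[ x ] y = y ≡ x ⊎ Adj x y

  _⊆N_ : Vertex → Vertex → Set
  x ⊆N y = ∀ z → N[ x ] z → N[ y ] z

  _≈N_ : Vertex → Vertex → Set
  x ≈N y = (x ⊆N y) × (y ⊆N x)

  MinimalN : Vertex → Set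
  MinimalN x = ∀ y → y ⊆N x → x ⊆N y

  -- A (fixed) choice of irredundant vertices: exactly one vertex in each
  -- class of vertices sharing the same inclusion-minimal closed neighbourhood.
  record IrredundantChoice : Set₁ where
    field
      Irr        : Vertex → Set
      irr-min    : ∀ {x} → Irr x → MinimalN x
      irr-unique : ∀ {x y} → Irr x → Irr y → x ≈N y → x ≡ y
      irr-exists : ∀ {x} → MinimalN x → Σ Vertex (λ y → Irr y × (y ≈N x))

  CycleAdj : (k : ℕ) → Fin k → Fin k → Set
  CycleAdj k i j =
    toℕ j ≡ suc (toℕ i) ⊎ toℕ i ≡ suc (toℕ j)
    ⊎ (toℕ i ≡ 0 × suc (toℕ j) ≡ k) ⊎ (toℕ j ≡ 0 × suc (toℕ i) ≡ k)

  PathAdj : (k : ℕ) → Fin k → Fin k → Set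
  PathAdj k i j = toℕ j ≡ suc (toℕ i) ⊎ toℕ i ≡ suc (toℕ j)

  InducedCycle : (k : ℕ) → (Fin k → Vertex) → Set
  InducedCycle k c =
    (∀ i j → c i ≡ c j → i ≡ j) × (∀ i j → Adj (c i) (c j) ⇔ CycleAdj k i j)

  InducedPath : (k : ℕ) → (Fin k → Vertex) → Set
  InducedPath k p =
    (∀ i j → p i ≡ p j → i ≡ j) × (∀ i j → Adj (p i) (p j) ⇔ PathAdj k i j)

  Chordal : Set
  Chordal = ∀ k → 4 ≤ k → (c : Fin k → Vertex) → ¬ InducedCycle k c

module Submission where

-- Distinct irredundant vertices have incomparable neighbourhoods,
-- so N[u] ⊈ N[v] and some u' ∈ N[u] ∖ N[v] exists (non-inclusion yields a
-- witness because adjacency is decidable on a finite vertex set).  Since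
-- v ∈ N[u] ∖ N[u'], minimality of N[u] forbids N[u'] ⊆ N[u], giving u''.
-- Exchanging u and v gives v', v''.
--
-- In a chordal graph a vertex x adjacent to the first
-- vertex of an induced path on at least three vertices, and far from all of
-- them but the last, is also far from the last one: otherwise x closes an
-- induced cycle of length at least four ('chordalFar').  Starting from the
-- edges and the non-edges at distance two, which come from the private
-- vertices, this yields all non-edges of u'' u' u v v' v''.

open import Defs
open import Data.Fin using (Fin; zero; suc; toℕ; _≟_)
open import Data.Fin.Properties using (¬∀⟶∃¬)
open import Data.Nat as ℕ using (zero; suc; z≤n; s≤s)
open import Data.Nat.Properties using (suc-injective; +-cancelˡ-≡)
open import Data.Vec using (Vec; _∷_; []; lookup; last)
open import Data.Vec.Functional using (fromVec)
open import Data.Vec.Relation.Unary.All using (All; _∷_; [])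
open import Data.Vec.Relation.Unary.All.Properties using (lookup⁺)
open import Data.Product using (Σ; _×_; _,_; proj₁; proj₂)
open import Data.Sum using (inj₁; inj₂; swap)
import Data.Sum as Sum
open import Data.Empty using (⊥-elim)
open import Function using (_∘_)
open import Function.Bundles using (_⇔_; mk⇔; Equivalence)
open import Function.Properties.Equivalence using () renaming (trans to ⇔-trans; sym to ⇔-sym)
open import Relation.Nullary using (¬_; Dec)
open import Relation.Nullary.Decidable using (_⊎-dec_; _→-dec_; decidable-stable)
open import Relation.Binary.PropositionalEquality as ≡ using (_≡_; _≢_; refl; cong)

open Equivalence using (to; from)

module _ (G : Graph) where
  open Graph G

  adj⇒≢ : ∀ {x y} → Adj x y → x ≢ y
  adj⇒≢ xy refl = irrefl xy

  N-sym : ∀ {x y} → N[_] G x y → N[_] G y x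
  N-sym (inj₁ refl) = inj₁ refl
  N-sym (inj₂ xy)   = inj₂ (sym xy)

  N? : ∀ x y → Dec (N[_] G x y)
  N? x y = (y ≟ x) ⊎-dec adj? x y

  outsideWitness : ∀ {a b} → ¬ _⊆N_ G a b →
                   Σ (Vertex G) λ z → N[_] G a z × ¬ N[_] G b z
  outsideWitness {a} {b} a⊈b with ¬∀⟶∃¬ n _ (λ z → N? a z →-dec N? b z) a⊈b
  ... | z , ¬a⇒b =
    z , decidable-stable (N? a z) (λ z∉Na → ¬a⇒b (⊥-elim ∘ z∉Na)) , ¬a⇒b ∘ λ z∈Nb _ → z∈Nb

  minimal-blocks : ∀ {x y w} → MinimalN G x → N[_] G x w → ¬ N[_] G y w →
                   ¬ _⊆N_ G y x
  minimal-blocks minX w∈Nx w∉Ny y⊆x = w∉Ny (minX _ y⊆x _ w∈Nx)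

  privateEdge : ∀ {a b z} → N[_] G b a → N[_] G a z → ¬ N[_] G b z → Adj a z
  privateEdge a∈Nb (inj₁ refl) z∉Nb = ⊥-elim (z∉Nb a∈Nb)
  privateEdge _    (inj₂ az)   _    = az

  Far : Vertex G → Vertex G → Set
  Far x z = ¬ Adj x z × x ≢ z

  far-sym : ∀ {x z} → Far x z → Far z x
  far-sym (¬xz , x≢z) = ¬xz ∘ sym , x≢z ∘ ≡.sym

  outside⇒far : ∀ {x z} → ¬ N[_] G x z → Far x z
  outside⇒far z∉Nx = z∉Nx ∘ inj₂ , z∉Nx ∘ inj₁ ∘ ≡.sym

  module _ (I : IrredundantChoice G) where
    open IrredundantChoice I

    incomparable : ∀ {u v} → Irr u → Irr v → u ≢ v → ¬ _⊆N_ G u v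
    incomparable iu iv u≢v u⊆v = u≢v (irr-unique iu iv (u⊆v , irr-min iv _ u⊆v))

    privateWalk : ∀ {u v} → Irr u → Irr v → Adj u v →
      Σ (Vertex G) λ u' → Σ (Vertex G) λ u'' →
        (N[_] G u u' × ¬ N[_] G v u') × (N[_] G u' u'' × ¬ N[_] G u u'')
    privateWalk iu iv uv with outsideWitness (incomparable iu iv (adj⇒≢ uv))
    ... | u' , u'∈Nu , u'∉Nv
        with outsideWitness (minimal-blocks (irr-min iu) (inj₂ uv) (u'∉Nv ∘ N-sym))
    ... | u'' , u''∈Nu' , u''∉Nu = u' , u'' , (u'∈Nu , u'∉Nv) , (u''∈Nu' , u''∉Nu)

  Induces : ∀ {k} → (Fin k → Fin k → Set) → (Fin k → Vertex G) → Set
  Induces R c = (∀ i j → c i ≡ c j → i ≡ j) × (∀ i j → Adj (c i) (c j) ⇔ R i j)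

  prepend : ∀ {k} (R : Fin (suc k) → Fin (suc k) → Set) →
    (∀ {i j} → R i j → R j i) → ¬ R zero zero →
    (∀ i j → R (suc i) (suc j) ⇔ PathAdj G k i j) →
    (c : Fin (suc k) → Vertex G) → InducedPath G k (c ∘ suc) →
    (∀ j → Adj (c zero) (c (suc j)) ⇔ R zero (suc j)) →
    (∀ j → c zero ≢ c (suc j)) →
    Induces R c
  prepend R R-sym R-irrefl R-shift c (inj , adj) contact new = injective , adjacency
    where
    injective : ∀ i j → c i ≡ c j → i ≡ j
    injective zero    zero    _ = refl
    injective zero    (suc j) e = ⊥-elim (new j e)
    injective (suc i) zero    e = ⊥-elim (new i (≡.sym e))
    injective (suc i) (suc j) e = cong suc (inj i j e)

    adjacency : ∀ i j → Adj (c i) (c j) ⇔ R i j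
    adjacency zero    zero    = mk⇔ (⊥-elim ∘ irrefl) (⊥-elim ∘ R-irrefl)
    adjacency zero    (suc j) = contact j
    adjacency (suc i) zero    =
      mk⇔ (R-sym ∘ to (contact i) ∘ sym) (sym ∘ from (contact i) ∘ R-sym)
    adjacency (suc i) (suc j) = ⇔-trans (adj i j) (⇔-sym (R-shift i j))

  pathAdj-sym : ∀ {k} {i j : Fin k} → PathAdj G k i j → PathAdj G k j i
  pathAdj-sym = swap

  pathAdj-irrefl : ∀ {k} → ¬ PathAdj G (suc k) zero zero
  pathAdj-irrefl (inj₁ ())
  pathAdj-irrefl (inj₂ ())

  pathAdj-shift : ∀ {k} (i j : Fin k) →
                  PathAdj G (suc k) (suc i) (suc j) ⇔ PathAdj G k i j
  pathAdj-shift i j =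
    mk⇔ (Sum.map suc-injective suc-injective) (Sum.map (cong suc) (cong suc))

  cycleAdj-sym : ∀ {k} {i j : Fin k} → CycleAdj G k i j → CycleAdj G k j i
  cycleAdj-sym (inj₁ p)               = inj₂ (inj₁ p)
  cycleAdj-sym (inj₂ (inj₁ p))        = inj₁ p
  cycleAdj-sym (inj₂ (inj₂ (inj₁ p))) = inj₂ (inj₂ (inj₂ p))
  cycleAdj-sym (inj₂ (inj₂ (inj₂ p))) = inj₂ (inj₂ (inj₁ p))

  cycleAdj-irrefl : ∀ {k} → ¬ CycleAdj G (suc (suc k)) zero zero
  cycleAdj-irrefl (inj₁ ())
  cycleAdj-irrefl (inj₂ (inj₁ ()))
  cycleAdj-irrefl (inj₂ (inj₂ (inj₁ (_ , ()))))
  cycleAdj-irrefl (inj₂ (inj₂ (inj₂ (_ , ()))))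

  cycleAdj-shift : ∀ {k} (i j : Fin k) →
                   CycleAdj G (suc k) (suc i) (suc j) ⇔ PathAdj G k i j
  cycleAdj-shift i j = mk⇔ onPath offZero
    where
    onPath : CycleAdj G _ (suc i) (suc j) → PathAdj G _ i j
    onPath (inj₁ p)                    = inj₁ (suc-injective p)
    onPath (inj₂ (inj₁ p))             = inj₂ (suc-injective p)
    onPath (inj₂ (inj₂ (inj₁ (() , _))))
    onPath (inj₂ (inj₂ (inj₂ (() , _))))
    offZero : PathAdj G _ i j → CycleAdj G _ (suc i) (suc j)
    offZero (inj₁ p) = inj₁ (cong suc p)
    offZero (inj₂ p) = inj₂ (inj₁ (cong suc p))

  singleton : ∀ {x} → InducedPath G 1 (fromVec (x ∷ []))
  singleton = (λ { zero zero _ → refl })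
            , (λ { zero zero → mk⇔ (⊥-elim ∘ irrefl) (⊥-elim ∘ pathAdj-irrefl {0}) })

  extendPath : ∀ {k x y} {zs : Vec (Vertex G) k} → Adj x y → All (Far x) zs →
    InducedPath G (suc k) (fromVec (y ∷ zs)) →
    InducedPath G (suc (suc k)) (fromVec (x ∷ y ∷ zs))
  extendPath {k} {x} {y} {zs} xy far P =
    prepend (PathAdj G (suc (suc k))) pathAdj-sym (pathAdj-irrefl {suc k}) pathAdj-shift _ P contact new
    where
    contact : ∀ j → Adj x (lookup (y ∷ zs) j) ⇔ PathAdj G (suc (suc k)) zero (suc j)
    contact zero    = mk⇔ (λ _ → inj₁ refl) (λ _ → xy)
    contact (suc j) = mk⇔ (⊥-elim ∘ proj₁ (lookup⁺ far j)) λ { (inj₁ ()) ; (inj₂ ()) }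
    new : ∀ j → x ≢ lookup (y ∷ zs) j
    new zero    = adj⇒≢ xy
    new (suc j) = proj₂ (lookup⁺ far j)

  FarUntilLast : ∀ {k} → Vertex G → Vec (Vertex G) (suc (suc k)) → Set
  FarUntilLast x (w ∷ z ∷ [])     = Far x w
  FarUntilLast x (w ∷ z ∷ u ∷ zs) = Far x w × FarUntilLast x (z ∷ u ∷ zs)

  lastContact : ∀ {k x} {zs : Vec (Vertex G) (suc (suc k))} →
    FarUntilLast x zs → Adj x (last zs) →
    ∀ j → Adj x (lookup zs j) ⇔ toℕ j ≡ ℕ.suc k
  lastContact {zs = _ ∷ _ ∷ []}    f        _ zero       = mk⇔ (⊥-elim ∘ proj₁ f) λ ()
  lastContact {zs = _ ∷ _ ∷ []}    _        a (suc zero) = mk⇔ (λ _ → refl) (λ _ → a)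
  lastContact {zs = _ ∷ _ ∷ _ ∷ _} (f , _)  _ zero       = mk⇔ (⊥-elim ∘ proj₁ f) λ ()
  lastContact {zs = _ ∷ _ ∷ _ ∷ _} (_ , fs) a (suc j)    =
    mk⇔ (λ b → cong ℕ.suc (to rest b)) (λ e → from rest (suc-injective e))
    where rest = lastContact fs a j

  lastNew : ∀ {k x} {zs : Vec (Vertex G) (suc (suc k))} →
    FarUntilLast x zs → Adj x (last zs) → ∀ j → x ≢ lookup zs j
  lastNew {zs = _ ∷ _ ∷ []}    f        _ zero       = proj₂ f
  lastNew {zs = _ ∷ _ ∷ []}    _        a (suc zero) = adj⇒≢ a
  lastNew {zs = _ ∷ _ ∷ _ ∷ _} (f , _)  _ zero       = proj₂ f
  lastNew {zs = _ ∷ _ ∷ _ ∷ _} (_ , fs) a (suc j)    = lastNew fs a j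

  closeCycle : ∀ {k x y} {zs : Vec (Vertex G) (suc (suc k))} →
    Adj x y → FarUntilLast x zs → Adj x (last zs) →
    InducedPath G (suc (suc (suc k))) (fromVec (y ∷ zs)) →
    InducedCycle G (suc (suc (suc (suc k)))) (fromVec (x ∷ y ∷ zs))
  closeCycle {k} {x} {y} {zs} xy f a P =
    prepend (CycleAdj G (suc (suc (suc (suc k))))) cycleAdj-sym (cycleAdj-irrefl {suc (suc k)}) cycleAdj-shift _ P contact new
    where
    contact : ∀ j → Adj x (lookup (y ∷ zs) j) ⇔ CycleAdj G (suc (suc (suc (suc k)))) zero (suc j)
    contact zero    = mk⇔ (λ _ → inj₁ refl) (λ _ → xy)
    contact (suc j) = mk⇔ (λ b → inj₂ (inj₂ (inj₁ (refl , cong (3 ℕ.+_) (to (lastContact f a j) b)))))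
      λ { (inj₁ ()) ; (inj₂ (inj₁ ())) ; (inj₂ (inj₂ (inj₂ (() , _))))
        ; (inj₂ (inj₂ (inj₁ (_ , e)))) → from (lastContact f a j) (+-cancelˡ-≡ 3 _ _ e) }
    new : ∀ j → x ≢ lookup (y ∷ zs) j
    new zero    = adj⇒≢ xy
    new (suc j) = lastNew f a j

  -- In a chordal graph: if x is adjacent to the first vertex y of an induced
  -- path y … z on at least three vertices and far from all of them but z,
  -- then x is far from z too (an edge xz would close an induced cycle of
  -- length ≥ 4, and x = z would make y adjacent to z).
  chordalFar : Chordal G → ∀ {k x y} {zs : Vec (Vertex G) (suc (suc k))} →
    Adj x y → ¬ Adj y (last zs) → FarUntilLast x zs →
    InducedPath G (suc (suc (suc k))) (fromVec (y ∷ zs)) → Far x (last zs)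
  chordalFar chordal xy ¬yz f P =
      (λ xz → chordal _ (s≤s (s≤s (s≤s (s≤s z≤n)))) _ (closeCycle xy f xz P))
    , λ { refl → ¬yz (sym xy) }

  chordalSixPath : Chordal G → ∀ {a b c d e f} →
    Adj a b → Adj b c → Adj c d → Adj d e → Adj e f →
    Far a c → Far b d → Far c e → Far d f →
    InducedPath G 6 (fromVec (a ∷ b ∷ c ∷ d ∷ e ∷ f ∷ []))
  chordalSixPath chordal {a} {b} {c} {d} {e} {f} ab bc cd de ef ac bd ce df =
    extendPath ab (ac ∷ ad ∷ ae ∷ af ∷ []) bcdef
    where
    -- Far pairs at distance 3, then 4, then 5, each from an induced path
    -- on the vertices strictly after the first member of the pair.
    def   : InducedPath G 3 (fromVec (d ∷ e ∷ f ∷ []))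
    def   = extendPath de (df ∷ []) (extendPath ef [] singleton)
    cde   : InducedPath G 3 (fromVec (c ∷ d ∷ e ∷ []))
    cde   = extendPath cd (ce ∷ []) (extendPath de [] singleton)
    bcd   : InducedPath G 3 (fromVec (b ∷ c ∷ d ∷ []))
    bcd   = extendPath bc (bd ∷ []) (extendPath cd [] singleton)
    ad    : Far a d
    ad    = chordalFar chordal ab (proj₁ bd) ac bcd
    be    : Far b e
    be    = chordalFar chordal bc (proj₁ ce) bd cde
    cf    : Far c f
    cf    = chordalFar chordal cd (proj₁ df) ce def
    cdef  : InducedPath G 4 (fromVec (c ∷ d ∷ e ∷ f ∷ []))
    cdef  = extendPath cd (ce ∷ cf ∷ []) def
    bcde  : InducedPath G 4 (fromVec (b ∷ c ∷ d ∷ e ∷ []))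
    bcde  = extendPath bc (bd ∷ be ∷ []) cde
    ae    : Far a e
    ae    = chordalFar chordal ab (proj₁ be) (ac , ad) bcde
    bf    : Far b f
    bf    = chordalFar chordal bc (proj₁ cf) (bd , be) cdef
    bcdef : InducedPath G 5 (fromVec (b ∷ c ∷ d ∷ e ∷ f ∷ []))
    bcdef = extendPath bc (bd ∷ be ∷ bf ∷ []) cdef
    af    : Far a f
    af    = chordalFar chordal ab (proj₁ bf) (ac , ad , ae) bcdef

proposition4 : (G : Graph) (I : IrredundantChoice G) →
    let open Graph G
        open IrredundantChoice I
    in (u v : Fin n) → Irr u → Irr v → Adj u v →
       Σ (Fin n) λ u' → Σ (Fin n) λ u'' → Σ (Fin n) λ v' → Σ (Fin n) λ v'' →
         (N[_] G u u' × ¬ N[_] G v u')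
         × (N[_] G u' u'' × ¬ N[_] G u u'')
         × (N[_] G v v' × ¬ N[_] G u v')
         × (N[_] G v' v'' × ¬ N[_] G v v'')
         × (Chordal G →
              InducedPath G 6 (fromVec (u'' ∷ u' ∷ u ∷ v ∷ v' ∷ v'' ∷ [])))
proposition4 G I u v iu iv uv
  with privateWalk G I iu iv uv | privateWalk G I iv iu (Graph.sym G uv)
... | u' , u'' , (u'∈Nu , u'∉Nv) , (u''∈Nu' , u''∉Nu)
    | v' , v'' , (v'∈Nv , v'∉Nu) , (v''∈Nv' , v''∉Nv) =
  u' , u'' , v' , v'' ,
  (u'∈Nu , u'∉Nv) , (u''∈Nu' , u''∉Nu) , (v'∈Nv , v'∉Nu) , (v''∈Nv' , v''∉Nv) ,
  λ chordal → chordalSixPath G chordal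
    (sym (privateEdge G u'∈Nu u''∈Nu' u''∉Nu))
    (sym (privateEdge G (inj₂ (sym uv)) u'∈Nu u'∉Nv))
    uv
    (privateEdge G (inj₂ uv) v'∈Nv v'∉Nu)
    (privateEdge G v'∈Nv v''∈Nv' v''∉Nv)
    (far-sym G (outside⇒far G u''∉Nu)) (far-sym G (outside⇒far G u'∉Nv))
    (outside⇒far G v'∉Nu) (outside⇒far G v''∉Nv)
  where open Graph G using (sym)
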